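{- Let $k\ge1$, let $G=(V,E)$ be a finite $(k+1)$-claw free graph with positive vertex weights $w$, let $O$ be a maximum-weight independent set and $A$ an independent set of $G$ with $N(o,A)\neq\emptyset$ for all $o\in O$. Suppose $A$ is locally optimal with respect to 1-exchanges. Let $0\le\delta\le\epsilon<1$, let $B$ be any set of vertices of $H_\epsilon$, and for $0\le t\le k$ define $\rho_t=\frac{t(\epsilon-\delta)}{1-\delta}-\frac{\epsilon-\delta}{1-\epsilon}$. Let $I$ be the set of isolated vertices of $H_\epsilon$. Then $$\sum_{a\in I}\left[\frac{\Delta_a}{w_a}+\frac{\Psi_a}{w_a}\right]\ge\sum_{a\in I}\big(\rho_{|C_a|}-\delta|C_a|\big)w_a+\sum_{a\in I}\sum_{o\in C_a}\delta\, w(N(o,B)).$$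
   Context: $(k+1)$-claw free: no induced subgraph consisting of a vertex adjacent to $k+1$ pairwise non-adjacent vertices. $w(X)=\sum_{v\in X}w_v$, $w^2(X)=\sum_{v\in X}w_v^2$. For $X,Y\subseteq V$, $N(X,Y)=\{y\in Y: y\text{ adjacent to some }x\in X\}\cup(X\cap Y)$, $N(v,Y)=N(\{v\},Y)$, $A-a=A\setminus\{a\}$. For $o\in O$, $\pi(o)$ is a vertex of $N(o,A)$ of maximum weight (ties broken arbitrarily but consistently). For $a\in A$: $C_a=\{o\in O:\pi(o)=a\}$, $N^+_a=\{a\}\cup\bigcup_{o\in C_a}N(o,A-a)$, $\psi_{a,o}=(w_o-w_a)^2+w_a\,w(N(o,A-a))-w^2(N(o,A-a))$, $\Psi_a=\sum_{o\in C_a}\psi_{a,o}$, $\Delta_a=w^2(N^+_a)-w^2(C_a)$. $A$ is locally optimal with respect to 1-exchanges if $w^2(C_a)\le w^2(N^+_a)$ for every $a\in A$. The exchange graph $H_\epsilon$ ($0\le\epsilon\le1$) is the directed graph with vertex set $A$ having an arc $(a,b)$, $a\neq b$, iff $a\in N^+_b$ and $w_a\ge(1-\epsilon)w_b$; a vertex is isolated if it is incident to no arc.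
   Formalization: The vertex weights $w$ and the parameters $\delta$ and $\epsilon$ take rational values. -}

module Defs where

open import Data.Bool using (Bool; true; false; _∧_; _∨_; if_then_else_; not)
open import Data.Nat using (ℕ; zero; suc)
open import Data.Fin using (Fin)
open import Data.Fin.Properties using () renaming (_≟_ to _≟ᶠ_)
open import Data.List using (List; foldr; map)
open import Data.Bool.ListAction using (any)
open import Data.List.Base using (allFin)
open import Data.Product using (Σ; ∃; _×_)
open import Relation.Nullary using (¬_; does)
open import Relation.Binary.PropositionalEquality using (_≡_; _≢_)
open import Function.Definitions using (Injective)
open import Data.Rational using (ℚ; 0ℚ; 1ℚ; _+_; _-_; _*_; _≤_; _<_; _÷_; ≢-nonZero)
open import Data.Rational.Properties using (_≟_; _≤?_)

record Graph (n : ℕ) : Set where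
  field
    adj   : Fin n → Fin n → Bool
    sym   : ∀ u v → adj u v ≡ adj v u
    irrefl : ∀ v → adj v v ≡ false

VSet : ℕ → Set
VSet n = Fin n → Bool

_∈ₛ_ : ∀ {n} → Fin n → VSet n → Set
v ∈ₛ X = X v ≡ true

-- Total division on ℚ (x / 0 := 0); only ever used with nonzero denominators.
_/ℚ_ : ℚ → ℚ → ℚ
p /ℚ q with q ≟ 0ℚ
... | Relation.Nullary.yes _ = 0ℚ
... | Relation.Nullary.no q≢0 = _÷_ p q {{≢-nonZero q≢0}}

_² : ℚ → ℚ
x ² = x * x

ΣS : ∀ {n} → VSet n → (Fin n → ℚ) → ℚ
ΣS {n} X f = foldr _+_ 0ℚ (map (λ v → if X v then f v else 0ℚ) (allFin n))

card : ∀ {n} → VSet n → ℕ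
card {n} X = foldr (λ v c → if X v then suc c else c) 0 (allFin n)

⟦_⟧ : ∀ {n} → Fin n → VSet n
⟦ v ⟧ u = does (u ≟ᶠ v)

wsum : ∀ {n} → (Fin n → ℚ) → VSet n → ℚ
wsum w X = ΣS X w

ℕ→ℚ : ℕ → ℚ
ℕ→ℚ zero = 0ℚ
ℕ→ℚ (suc m) = 1ℚ + ℕ→ℚ m

module _ {n : ℕ} (G : Graph n) where
  open Graph G

  Independent : VSet n → Set
  Independent S = ∀ u v → u ∈ₛ S → v ∈ₛ S → adj u v ≡ false

  ClawFree : ℕ → Set
  ClawFree k = ¬ (Σ (Fin n) λ c → Σ (Fin (suc k) → Fin n) λ f →
                    Injective _≡_ _≡_ f
                  × (∀ i → adj c (f i) ≡ true)
                  × (∀ i j → i ≢ j → adj (f i) (f j) ≡ false))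

  N : VSet n → VSet n → VSet n
  N X Y y = Y y ∧ (any (λ x → X x ∧ adj x y) (allFin n) ∨ X y)


  _∖_ : VSet n → Fin n → VSet n
  (X ∖ a) u = X u ∧ not (does (u ≟ᶠ a))

  module Ctx (w : Fin n → ℚ) (A O : VSet n) (π : Fin n → Fin n) where

    wt : VSet n → ℚ
    wt X = wsum w X

    wt² : VSet n → ℚ
    wt² X = ΣS X (λ v → (w v) ²)

    IsPi : Set
    IsPi = ∀ o → o ∈ₛ O → (π o ∈ₛ N ⟦ o ⟧ A) × (∀ a → a ∈ₛ N ⟦ o ⟧ A → w a ≤ w (π o))

    C : Fin n → VSet n
    C a o = O o ∧ does (π o ≟ᶠ a)

    N⁺ : Fin n → VSet n
    N⁺ a v = does (v ≟ᶠ a) ∨ any (λ o → C a o ∧ N ⟦ o ⟧ (A ∖ a) v) (allFin n)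

    ψ : Fin n → Fin n → ℚ
    ψ a o = ((w o - w a) ²) + w a * wt (N ⟦ o ⟧ (A ∖ a)) - wt² (N ⟦ o ⟧ (A ∖ a))

    Ψ : Fin n → ℚ
    Ψ a = ΣS (C a) (ψ a)

    Δ : Fin n → ℚ
    Δ a = wt² (N⁺ a) - wt² (C a)

    LocallyOptimal : Set
    LocallyOptimal = ∀ a → a ∈ₛ A → wt² (C a) ≤ wt² (N⁺ a)

    -- arc (a,b) of the exchange graph H_ε (vertex set A)
    arc : ℚ → Fin n → Fin n → Bool
    arc ε a b = A a ∧ A b ∧ not (does (a ≟ᶠ b)) ∧ N⁺ b a
                ∧ does (((1ℚ - ε) * w b) ≤? w a)

    Isolated : ℚ → VSet n
    Isolated ε a = A a ∧ not (any (λ b → arc ε a b ∨ arc ε b a) (allFin n))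

    ρ : ℚ → ℚ → ℕ → ℚ
    ρ ε δ t = ((ℕ→ℚ t * (ε - δ)) /ℚ (1ℚ - δ)) - ((ε - δ) /ℚ (1ℚ - ε))

-- Let a be isolated in H_ε, t = |C_a|, c = (1 - δ)/(1 - ε) and u = 1/c. Every v in
-- N(o, A - a) with o ∈ C_a lies in N⁺_a and is not the tail of an arc into a, so
-- w_v < (1 - ε) w_a, whence c w²(N(o,A-a)) ≤ (1 - δ) w_a w(N(o,A-a)). Together with
-- 2 w_a w_o ≤ u w_a² + c w_o² (completing the square, as c u = 1) and
-- w(N(o,B)) ≤ w_a + w(N(o,A-a)) this bounds ψ_{a,o} below by
-- (1 - c) w_o² + (1 - u - δ) w_a² + δ w_a w(N(o,B)) + (c - 1) w²(N(o,A-a)).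
-- Summing over C_a, local optimality w²(C_a) ≤ w²(N⁺_a) and the union bound
-- w²(N⁺_a) ≤ w_a² + Σ_o w²(N(o,A-a)) leave
-- Δ_a + Ψ_a ≥ w_a ((ρ_t - δ t) w_a + δ Σ_o w(N(o,B))), since ρ_t = t (1 - u) - (c - 1).
-- Divide by w_a and sum over the isolated vertices.
module Submission where

open import Defs
open import Data.Nat using (ℕ) renaming (_≥_ to _≥ⁿ_)
open import Data.Fin using (Fin)
open import Data.Product using (Σ; _×_)
open import Relation.Binary.PropositionalEquality using (_≡_)
open import Data.Rational using (ℚ; 0ℚ; 1ℚ; _+_; _-_; _*_; _≤_; _<_; _≥_)

open import Algebra.Bundles using (CommutativeRing)
open import Data.Bool using (Bool; true; false; _∧_; _∨_; not; if_then_else_)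
open import Data.Bool.ListAction using (any)
open import Data.Bool.Properties using (∧-conicalˡ; ∧-conicalʳ; ∨-conicalʳ; ∨-zeroʳ; not-injective; T-≡)
open import Data.Empty using (⊥-elim)
open import Data.Fin using (zero; suc; punchIn)
open import Data.Fin.Properties using (punchInᵢ≢i) renaming (_≟_ to _≟ᶠ_)
open import Data.List using (List; []; _∷_; foldr; map; tabulate; allFin)
open import Data.List.Membership.Propositional using (lose)
open import Data.List.Membership.Propositional.Properties using (∈-allFin)
open import Data.List.Properties using (map-tabulate)
open import Data.List.Relation.Unary.Any.Properties using (any⁺)
open import Data.Nat using (zero; suc)
open import Data.Rational using (-_; _÷_; 1/_; NonZero; >-nonZero; ≢-nonZero; positive; nonNegative; nonPositive)
open import Data.Rational.Properties
open import Data.Sum using (inj₁; inj₂)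
open import Data.Vec.Functional using (removeAt)
open import Function using (id; _∘_; case_of_)
open import Function.Bundles using (Equivalence)
open import Relation.Binary.PropositionalEquality using (refl; sym; trans; cong; cong₂; _≢_; module ≡-Reasoning)
open import Relation.Nullary.Decidable using (Dec; yes; no; does; dec⇒maybe; dec-true; dec-false)
open import Tactic.RingSolver using (solve-∀)
open import Tactic.RingSolver.Core.AlmostCommutativeRing using (AlmostCommutativeRing; fromCommutativeRing)

open import Algebra.Properties.Semiring.Sum (CommutativeRing.semiring +-*-commutativeRing)
  using (sum; sum-syntax; ∑-distrib-+; ∑-comm; *-distribˡ-sum; sum-cong-≗; sum-remove; sum-replicate-zero)

ℚ-ring : AlmostCommutativeRing _ _
ℚ-ring = fromCommutativeRing +-*-commutativeRing (λ x → dec⇒maybe (0ℚ ≟ x))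

p≤p+q : ∀ {p q} → 0ℚ ≤ q → p ≤ p + q
p≤p+q {p} {q} 0≤q = begin
  p       ≡⟨ +-identityʳ p ⟨
  p + 0ℚ  ≤⟨ +-monoʳ-≤ p 0≤q ⟩
  p + q   ∎
  where open ≤-Reasoning

nonNeg-+ : ∀ {p q} → 0ℚ ≤ p → 0ℚ ≤ q → 0ℚ ≤ p + q
nonNeg-+ = +-mono-≤

nonNeg-* : ∀ {p q} → 0ℚ ≤ p → 0ℚ ≤ q → 0ℚ ≤ p * q
nonNeg-* {p} {q} 0≤p 0≤q = nonNegative⁻¹ (p * q) {{nonNeg*nonNeg⇒nonNeg p {{nonNegative 0≤p}} q {{nonNegative 0≤q}}}}

0≤p*p : ∀ p → 0ℚ ≤ p * p
0≤p*p p with ≤-total 0ℚ p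
... | inj₁ 0≤p = nonNeg-* 0≤p 0≤p
... | inj₂ p≤0 = nonNegative⁻¹ (p * p) {{nonPos*nonPos⇒nonPos p {{nonPositive p≤0}} p {{nonPositive p≤0}}}}

≤-by-gap : ∀ {x y} z → 0ℚ ≤ z → x + z ≡ y → x ≤ y
≤-by-gap {x} {y} z 0≤z x+z≡y = ≤-trans (p≤p+q 0≤z) (≤-reflexive x+z≡y)

p≤q⇒0≤q-p : ∀ {p q} → p ≤ q → 0ℚ ≤ q - p
p≤q⇒0≤q-p {p} {q} p≤q = begin
  0ℚ      ≡⟨ +-inverseʳ p ⟨
  p - p   ≤⟨ +-monoˡ-≤ (- p) p≤q ⟩
  q - p   ∎
  where open ≤-Reasoning

p<q⇒0<q-p : ∀ {p q} → p < q → 0ℚ < q - p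
p<q⇒0<q-p {p} {q} p<q = begin-strict
  0ℚ      ≡⟨ +-inverseʳ p ⟨
  p - p   <⟨ +-monoˡ-< (- p) p<q ⟩
  q - p   ∎
  where open ≤-Reasoning

0<1/p : ∀ {p} (0<p : 0ℚ < p) → 0ℚ < (1/ p) {{>-nonZero 0<p}}
0<1/p {p} 0<p = positive⁻¹ _ {{1/pos⇒pos p {{positive 0<p}}}}

/ℚ≡÷ : ∀ p {q} (0<q : 0ℚ < q) → p /ℚ q ≡ (p ÷ q) {{>-nonZero 0<q}}
/ℚ≡÷ p {q} 0<q with q ≟ 0ℚ
... | yes refl = ⊥-elim (<-irrefl refl 0<q)
... | no _     = refl

/ℚ-distribʳ-+ : ∀ p q r → (p + q) /ℚ r ≡ p /ℚ r + q /ℚ r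
/ℚ-distribʳ-+ p q r with r ≟ 0ℚ
... | yes _   = sym (+-identityˡ 0ℚ)
... | no r≢0 = *-distribʳ-+ ((1/ r) {{≢-nonZero r≢0}}) p q

p*r≤q⇒p≤q/r : ∀ {p q r} → 0ℚ < r → p * r ≤ q → p ≤ q /ℚ r
p*r≤q⇒p≤q/r {p} {q} {r} 0<r pr≤q = begin
  p                ≡⟨ *-identityʳ p ⟨
  p * 1ℚ           ≡⟨ cong (p *_) (*-inverseʳ r) ⟨
  p * (r * 1/ r)   ≡⟨ *-assoc p r (1/ r) ⟨
  p * r * 1/ r     ≤⟨ *-monoʳ-≤-nonNeg (1/ r) {{nonNegative (<⇒≤ (0<1/p 0<r))}} pr≤q ⟩
  q * 1/ r         ≡⟨ /ℚ≡÷ q 0<r ⟨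
  q /ℚ r           ∎
  where
  open ≤-Reasoning
  instance
    r≢0 : NonZero r
    r≢0 = >-nonZero 0<r

infix 5 _when_

_when_ : ℚ → Bool → ℚ
x when b = if b then x else 0ℚ

when-+ : ∀ b x y → (x + y) when b ≡ (x when b) + (y when b)
when-+ true  x y = refl
when-+ false x y = sym (+-identityˡ 0ℚ)

when-* : ∀ b k x → (k * x) when b ≡ k * (x when b)
when-* true  k x = refl
when-* false k x = sym (*-zeroʳ k)

when-∧ : ∀ b c x → x when (b ∧ c) ≡ (x when c) when b
when-∧ true  c x = refl
when-∧ false c x = refl

when-nonNeg : ∀ b {x} → 0ℚ ≤ x → 0ℚ ≤ x when b
when-nonNeg true  0≤x = 0≤x
when-nonNeg false _   = ≤-refl

when-mono-≤ : ∀ b {x y} → (b ≡ true → x ≤ y) → x when b ≤ y when b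
when-mono-≤ true  x≤y = x≤y refl
when-mono-≤ false _   = ≤-refl

when-⇒ : ∀ b c {x} → (b ≡ true → c ≡ true) → 0ℚ ≤ x → x when b ≤ x when c
when-⇒ true  c b⇒c _ rewrite b⇒c refl = ≤-refl
when-⇒ false c _   0≤x = when-nonNeg c 0≤x

when-∨ : ∀ b c {x} → 0ℚ ≤ x → x when (b ∨ c) ≤ (x when b) + (x when c)
when-∨ true  true  0≤x = p≤p+q 0≤x
when-∨ true  false _   = ≤-reflexive (sym (+-identityʳ _))
when-∨ false c     _   = ≤-reflexive (sym (+-identityˡ _))

when-any-tabulate : ∀ {A : Set} {m} (P : A → Bool) (h : Fin m → A) {x} → 0ℚ ≤ x →
                    x when any P (tabulate h) ≤ ∑[ i < m ] (x when P (h i))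
when-any-tabulate {m = zero}  P h 0≤x = ≤-refl
when-any-tabulate {m = suc m} P h {x} 0≤x =
  ≤-trans (when-∨ (P (h zero)) (any P (tabulate (h ∘ suc))) 0≤x)
          (+-monoʳ-≤ (x when P (h zero)) (when-any-tabulate P (h ∘ suc) 0≤x))

sum-when : ∀ b m (f : Fin m → ℚ) → sum f when b ≡ ∑[ i < m ] (f i when b)
sum-when true  m f = refl
sum-when false m f = sym (sum-replicate-zero m)

∑-mono-≤ : ∀ {m} {f g : Fin m → ℚ} → (∀ i → f i ≤ g i) → sum f ≤ sum g
∑-mono-≤ {zero}  _   = ≤-refl
∑-mono-≤ {suc m} f≤g = +-mono-≤ (f≤g zero) (∑-mono-≤ (f≤g ∘ suc))

foldr-+-tabulate : ∀ {m} (f : Fin m → ℚ) → foldr _+_ 0ℚ (tabulate f) ≡ sum f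
foldr-+-tabulate {zero}  f = refl
foldr-+-tabulate {suc m} f = cong (f zero +_) (foldr-+-tabulate (f ∘ suc))

_∪_ : ∀ {n} → VSet n → VSet n → VSet n
(X ∪ Y) v = X v ∨ Y v

⋃ : ∀ {n} → VSet n → (Fin n → VSet n) → VSet n
⋃ {n} C S v = any (λ o → C o ∧ S o v) (allFin n)

module _ {n : ℕ} where

  ΣS≡∑ : (X : VSet n) (f : Fin n → ℚ) → ΣS X f ≡ ∑[ v < n ] (f v when X v)
  ΣS≡∑ X f = trans (cong (foldr _+_ 0ℚ) (map-tabulate id g)) (foldr-+-tabulate g)
    where g = λ v → f v when X v

  ΣS-+ : (X : VSet n) (f g : Fin n → ℚ) → ΣS X (λ v → f v + g v) ≡ ΣS X f + ΣS X g
  ΣS-+ X f g = begin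
    ΣS X (λ v → f v + g v)                          ≡⟨ ΣS≡∑ X (λ v → f v + g v) ⟩
    ∑[ v < n ] ((f v + g v) when X v)               ≡⟨ sum-cong-≗ (λ v → when-+ (X v) (f v) (g v)) ⟩
    ∑[ v < n ] ((f v when X v) + (g v when X v))    ≡⟨ ∑-distrib-+ (λ v → f v when X v) (λ v → g v when X v) ⟩
    ∑[ v < n ] (f v when X v) + ∑[ v < n ] (g v when X v) ≡⟨ cong₂ _+_ (ΣS≡∑ X f) (ΣS≡∑ X g) ⟨
    ΣS X f + ΣS X g                                 ∎
    where open ≡-Reasoning

  ΣS-* : (X : VSet n) (k : ℚ) (f : Fin n → ℚ) → ΣS X (λ v → k * f v) ≡ k * ΣS X f
  ΣS-* X k f = begin
    ΣS X (λ v → k * f v)               ≡⟨ ΣS≡∑ X (λ v → k * f v) ⟩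
    ∑[ v < n ] ((k * f v) when X v)    ≡⟨ sum-cong-≗ (λ v → when-* (X v) k (f v)) ⟩
    ∑[ v < n ] (k * (f v when X v))    ≡⟨ *-distribˡ-sum k (λ v → f v when X v) ⟨
    k * ∑[ v < n ] (f v when X v)      ≡⟨ cong (k *_) (ΣS≡∑ X f) ⟨
    k * ΣS X f                         ∎
    where open ≡-Reasoning

  ΣS-mono-≤ : (X : VSet n) {f g : Fin n → ℚ} → (∀ v → v ∈ₛ X → f v ≤ g v) → ΣS X f ≤ ΣS X g
  ΣS-mono-≤ X {f} {g} f≤g = begin
    ΣS X f                     ≡⟨ ΣS≡∑ X f ⟩
    ∑[ v < n ] (f v when X v)  ≤⟨ ∑-mono-≤ (λ v → when-mono-≤ (X v) (f≤g v)) ⟩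
    ∑[ v < n ] (g v when X v)  ≡⟨ ΣS≡∑ X g ⟨
    ΣS X g                     ∎
    where open ≤-Reasoning

  ΣS-mono-⊆ : {X Y : VSet n} (f : Fin n → ℚ) → (∀ v → 0ℚ ≤ f v) →
              (∀ v → v ∈ₛ X → v ∈ₛ Y) → ΣS X f ≤ ΣS Y f
  ΣS-mono-⊆ {X} {Y} f 0≤f X⊆Y = begin
    ΣS X f                     ≡⟨ ΣS≡∑ X f ⟩
    ∑[ v < n ] (f v when X v)  ≤⟨ ∑-mono-≤ (λ v → when-⇒ (X v) (Y v) (X⊆Y v) (0≤f v)) ⟩
    ∑[ v < n ] (f v when Y v)  ≡⟨ ΣS≡∑ Y f ⟨
    ΣS Y f                     ∎
    where open ≤-Reasoning

  ΣS-∪ : (X Y : VSet n) (f : Fin n → ℚ) → (∀ v → 0ℚ ≤ f v) → ΣS (X ∪ Y) f ≤ ΣS X f + ΣS Y f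
  ΣS-∪ X Y f 0≤f = begin
    ΣS (X ∪ Y) f                                      ≡⟨ ΣS≡∑ (X ∪ Y) f ⟩
    ∑[ v < n ] (f v when (X v ∨ Y v))                 ≤⟨ ∑-mono-≤ (λ v → when-∨ (X v) (Y v) (0≤f v)) ⟩
    ∑[ v < n ] ((f v when X v) + (f v when Y v))      ≡⟨ ∑-distrib-+ (λ v → f v when X v) (λ v → f v when Y v) ⟩
    ∑[ v < n ] (f v when X v) + ∑[ v < n ] (f v when Y v) ≡⟨ cong₂ _+_ (ΣS≡∑ X f) (ΣS≡∑ Y f) ⟨
    ΣS X f + ΣS Y f                                   ∎
    where open ≤-Reasoning

  ΣS-⋃ : (C : VSet n) (S : Fin n → VSet n) (f : Fin n → ℚ) → (∀ v → 0ℚ ≤ f v) →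
         ΣS (⋃ C S) f ≤ ΣS C (λ o → ΣS (S o) f)
  ΣS-⋃ C S f 0≤f = begin
    ΣS (⋃ C S) f                                          ≡⟨ ΣS≡∑ (⋃ C S) f ⟩
    ∑[ v < n ] (f v when ⋃ C S v)                         ≤⟨ ∑-mono-≤ union-bound ⟩
    ∑[ v < n ] ∑[ o < n ] (f v when (C o ∧ S o v))        ≡⟨ ∑-comm (λ v o → f v when (C o ∧ S o v)) ⟩
    ∑[ o < n ] ∑[ v < n ] (f v when (C o ∧ S o v))        ≡⟨ sum-cong-≗ inner ⟩
    ∑[ o < n ] (ΣS (S o) f when C o)                      ≡⟨ ΣS≡∑ C (λ o → ΣS (S o) f) ⟨
    ΣS C (λ o → ΣS (S o) f)                               ∎
    where
    open ≤-Reasoning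
    union-bound : ∀ v → f v when ⋃ C S v ≤ ∑[ o < n ] (f v when (C o ∧ S o v))
    union-bound v = when-any-tabulate (λ o → C o ∧ S o v) id (0≤f v)
    inner : ∀ o → ∑[ v < n ] (f v when (C o ∧ S o v)) ≡ ΣS (S o) f when C o
    inner o = begin-equality
      ∑[ v < n ] (f v when (C o ∧ S o v))   ≡⟨ sum-cong-≗ (λ v → when-∧ (C o) (S o v) (f v)) ⟩
      ∑[ v < n ] ((f v when S o v) when C o) ≡⟨ sum-when (C o) n (λ v → f v when S o v) ⟨
      ∑[ v < n ] (f v when S o v) when C o   ≡⟨ cong (_when C o) (ΣS≡∑ (S o) f) ⟨
      ΣS (S o) f when C o                    ∎

  ΣS-square-≤ : (X : VSet n) (f : Fin n → ℚ) → (∀ v → 0ℚ ≤ f v) → ∀ {c b} →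
                (∀ v → v ∈ₛ X → c * f v ≤ b) → c * ΣS X (λ v → f v * f v) ≤ b * ΣS X f
  ΣS-square-≤ X f 0≤f {c} {b} cf≤b = begin
    c * ΣS X (λ v → f v * f v)    ≡⟨ ΣS-* X c (λ v → f v * f v) ⟨
    ΣS X (λ v → c * (f v * f v))  ≤⟨ ΣS-mono-≤ X pointwise ⟩
    ΣS X (λ v → b * f v)          ≡⟨ ΣS-* X b f ⟩
    b * ΣS X f                    ∎
    where
    open ≤-Reasoning
    pointwise : ∀ v → v ∈ₛ X → c * (f v * f v) ≤ b * f v
    pointwise v v∈X = ≤-trans (≤-reflexive (sym (*-assoc c (f v) (f v))))
                              (*-monoʳ-≤-nonNeg (f v) {{nonNegative (0≤f v)}} (cf≤b v v∈X))

  ΣS-const : (X : VSet n) (k : ℚ) → ΣS X (λ _ → k) ≡ ℕ→ℚ (card X) * k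
  ΣS-const X k = count-sum (allFin n)
    where
    count : List (Fin n) → ℕ
    count = foldr (λ v c → if X v then suc c else c) 0
    count-sum : ∀ vs → foldr _+_ 0ℚ (map (λ v → k when X v) vs) ≡ ℕ→ℚ (count vs) * k
    count-sum []       = sym (*-zeroˡ k)
    count-sum (v ∷ vs) with X v
    ... | true  = begin
      k + foldr _+_ 0ℚ (map (λ v → k when X v) vs) ≡⟨ cong (k +_) (count-sum vs) ⟩
      k + ℕ→ℚ (count vs) * k                       ≡⟨ cong (_+ ℕ→ℚ (count vs) * k) (*-identityˡ k) ⟨
      1ℚ * k + ℕ→ℚ (count vs) * k                  ≡⟨ *-distribʳ-+ k 1ℚ (ℕ→ℚ (count vs)) ⟨
      (1ℚ + ℕ→ℚ (count vs)) * k                    ∎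
      where open ≡-Reasoning
    ... | false = trans (+-identityˡ _) (count-sum vs)

ΣS-⟦⟧ : ∀ {n} (a : Fin n) (f : Fin n → ℚ) → ΣS ⟦ a ⟧ f ≡ f a
ΣS-⟦⟧ {suc m} a f = begin
  ΣS ⟦ a ⟧ f                  ≡⟨ ΣS≡∑ ⟦ a ⟧ f ⟩
  sum t                       ≡⟨ sum-remove {i = a} t ⟩
  t a + sum (removeAt t a)    ≡⟨ cong₂ _+_ t[a] (trans (sum-cong-≗ t[≢a]) (sum-replicate-zero m)) ⟩
  f a + 0ℚ                    ≡⟨ +-identityʳ (f a) ⟩
  f a                         ∎
  where
  open ≡-Reasoning
  t : Fin (suc m) → ℚ
  t v = f v when ⟦ a ⟧ v
  t[a] : t a ≡ f a
  t[a] rewrite dec-true (a ≟ᶠ a) refl = refl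
  t[≢a] : ∀ k → t (punchIn a k) ≡ 0ℚ
  t[≢a] k rewrite dec-false (punchIn a k ≟ᶠ a) (punchInᵢ≢i a k) = refl

any-allFin : ∀ {n} (P : Fin n → Bool) i → P i ≡ true → any P (allFin n) ≡ true
any-allFin P i Pi = Equivalence.to T-≡ (any⁺ P (lose (∈-allFin i) (Equivalence.from T-≡ Pi)))

any-allFin-false : ∀ {n} (P : Fin n → Bool) → any P (allFin n) ≡ false → ∀ i → P i ≡ false
any-allFin-false P ¬any i with P i in Pi
... | false = refl
... | true  = trans (sym (any-allFin P i Pi)) ¬any

amgm-weighted : ∀ {c u} x y → c * u ≡ 1ℚ → 0ℚ ≤ u → x * y + x * y ≤ u * (x * x) + c * (y * y)
amgm-weighted {c} {u} x y cu≡1 0≤u = begin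
  x * y + x * y                                                ≡⟨ *-identityʳ _ ⟨
  (x * y + x * y) * 1ℚ                                         ≡⟨ cong ((x * y + x * y) *_) cu≡1 ⟨
  (x * y + x * y) * (c * u)                                    ≤⟨ p≤p+q (nonNeg-* 0≤u (0≤p*p (x - c * y))) ⟩
  (x * y + x * y) * (c * u) + u * ((x - c * y) * (x - c * y))  ≡⟨ expand x y c u ⟩
  u * (x * x) + c * (c * u) * (y * y)                          ≡⟨ cong (λ k → u * (x * x) + c * k * (y * y)) cu≡1 ⟩
  u * (x * x) + c * 1ℚ * (y * y)                               ≡⟨ cong (λ k → u * (x * x) + k * (y * y)) (*-identityʳ c) ⟩
  u * (x * x) + c * (y * y)                                    ∎
  where
  open ≤-Reasoning
  expand : ∀ x y c u → (x * y + x * y) * (c * u) + u * ((x - c * y) * (x - c * y))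
                       ≡ u * (x * x) + c * (c * u) * (y * y)
  expand = solve-∀ ℚ-ring

ψ-lower-bound-ℚ : ∀ wo wa L Q NB δ c u →
  wa * wo + wa * wo ≤ u * (wa * wa) + c * (wo * wo) →
  c * Q ≤ (1ℚ - δ) * wa * L →
  δ * wa * NB ≤ δ * wa * (wa + L) →
  (1ℚ - c) * (wo * wo) + (1ℚ - u - δ) * (wa * wa) + wa * (δ * NB) + (c - 1ℚ) * Q
    ≤ (wo - wa) * (wo - wa) + wa * L - Q
ψ-lower-bound-ℚ wo wa L Q NB δ c u h₁ h₂ h₃ =
  ≤-by-gap _ (nonNeg-+ (nonNeg-+ (p≤q⇒0≤q-p h₁) (p≤q⇒0≤q-p h₂)) (p≤q⇒0≤q-p h₃)) (identity wo wa L Q NB δ c u)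
  where
  identity : ∀ wo wa L Q NB δ c u →
    (1ℚ - c) * (wo * wo) + (1ℚ - u - δ) * (wa * wa) + wa * (δ * NB) + (c - 1ℚ) * Q
      + (((u * (wa * wa) + c * (wo * wo)) - (wa * wo + wa * wo)
         + ((1ℚ - δ) * wa * L - c * Q))
         + (δ * wa * (wa + L) - δ * wa * NB))
    ≡ (wo - wa) * (wo - wa) + wa * L - Q
  identity = solve-∀ ℚ-ring

Δ+Ψ-lower-bound-ℚ : ∀ X SW SQ T wa t δ c u → 1ℚ ≤ c → SW ≤ X → X ≤ wa * wa + SQ →
  ((t * (1ℚ - u) - (c - 1ℚ) - δ * t) * wa + T) * wa
    ≤ (X - SW) + ((1ℚ - c) * SW + t * ((1ℚ - u - δ) * (wa * wa)) + wa * T + (c - 1ℚ) * SQ)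
Δ+Ψ-lower-bound-ℚ X SW SQ T wa t δ c u 1≤c SW≤X X≤wa²+SQ =
  ≤-by-gap _ (nonNeg-+ (nonNeg-* (≤-trans (nonNegative⁻¹ 1ℚ) 1≤c) (p≤q⇒0≤q-p SW≤X))
                       (nonNeg-* (p≤q⇒0≤q-p 1≤c) (p≤q⇒0≤q-p X≤wa²+SQ)))
    (identity X SW SQ T wa t δ c u)
  where
  identity : ∀ X SW SQ T wa t δ c u →
    ((t * (1ℚ - u) - (c - 1ℚ) - δ * t) * wa + T) * wa
      + (c * (X - SW) + (c - 1ℚ) * ((wa * wa + SQ) - X))
    ≡ (X - SW) + ((1ℚ - c) * SW + t * ((1ℚ - u - δ) * (wa * wa)) + wa * T + (c - 1ℚ) * SQ)
  identity = solve-∀ ℚ-ring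

-- c rescales the bound (1 - ε) w_a on light neighbours to (1 - δ) w_a, and u = 1 / c.
module ExchangeConstants {δ ε : ℚ} (δ≤ε : δ ≤ ε) (ε<1 : ε < 1ℚ) where

  private
    0<1-ε : 0ℚ < 1ℚ - ε
    0<1-ε = p<q⇒0<q-p ε<1
    0<1-δ : 0ℚ < 1ℚ - δ
    0<1-δ = p<q⇒0<q-p (≤-<-trans δ≤ε ε<1)
    instance
      1-ε≢0 : NonZero (1ℚ - ε)
      1-ε≢0 = >-nonZero 0<1-ε
      1-δ≢0 : NonZero (1ℚ - δ)
      1-δ≢0 = >-nonZero 0<1-δ

  c u : ℚ
  c = (1ℚ - δ) ÷ (1ℚ - ε)
  u = (1ℚ - ε) ÷ (1ℚ - δ)

  c*u≡1 : c * u ≡ 1ℚ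
  c*u≡1 = begin
    ((1ℚ - δ) * 1/ (1ℚ - ε)) * ((1ℚ - ε) * 1/ (1ℚ - δ))  ≡⟨ swap (1ℚ - δ) (1/ (1ℚ - ε)) (1ℚ - ε) (1/ (1ℚ - δ)) ⟩
    ((1ℚ - δ) * 1/ (1ℚ - δ)) * ((1ℚ - ε) * 1/ (1ℚ - ε))  ≡⟨ cong₂ _*_ (*-inverseʳ (1ℚ - δ)) (*-inverseʳ (1ℚ - ε)) ⟩
    1ℚ * 1ℚ                                              ≡⟨ *-identityˡ 1ℚ ⟩
    1ℚ                                                   ∎
    where
    open ≡-Reasoning
    swap : ∀ a b c d → (a * b) * (c * d) ≡ (a * d) * (c * b)
    swap = solve-∀ ℚ-ring

  c*[1-ε]≡1-δ : c * (1ℚ - ε) ≡ 1ℚ - δ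
  c*[1-ε]≡1-δ = begin
    ((1ℚ - δ) * 1/ (1ℚ - ε)) * (1ℚ - ε)  ≡⟨ *-assoc (1ℚ - δ) _ (1ℚ - ε) ⟩
    (1ℚ - δ) * (1/ (1ℚ - ε) * (1ℚ - ε))  ≡⟨ cong ((1ℚ - δ) *_) (*-inverseˡ (1ℚ - ε)) ⟩
    (1ℚ - δ) * 1ℚ                        ≡⟨ *-identityʳ (1ℚ - δ) ⟩
    1ℚ - δ                               ∎
    where open ≡-Reasoning

  0≤u : 0ℚ ≤ u
  0≤u = nonNeg-* (<⇒≤ 0<1-ε) (<⇒≤ (0<1/p 0<1-δ))

  1≤c : 1ℚ ≤ c
  1≤c = begin
    1ℚ                          ≡⟨ *-inverseʳ (1ℚ - ε) ⟨
    (1ℚ - ε) * 1/ (1ℚ - ε)      ≤⟨ *-monoʳ-≤-nonNeg (1/ (1ℚ - ε)) {{nonNegative (<⇒≤ (0<1/p 0<1-ε))}}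
                                     (+-monoʳ-≤ 1ℚ (neg-antimono-≤ δ≤ε)) ⟩
    (1ℚ - δ) * 1/ (1ℚ - ε)      ∎
    where open ≤-Reasoning

  ρ≡ : ∀ x → (x * (ε - δ)) /ℚ (1ℚ - δ) - (ε - δ) /ℚ (1ℚ - ε) ≡ x * (1ℚ - u) - (c - 1ℚ)
  ρ≡ x = begin
    (x * (ε - δ)) /ℚ (1ℚ - δ) - (ε - δ) /ℚ (1ℚ - ε)
      ≡⟨ cong₂ _-_ (/ℚ≡÷ (x * (ε - δ)) 0<1-δ) (/ℚ≡÷ (ε - δ) 0<1-ε) ⟩
    x * (ε - δ) * 1/ (1ℚ - δ) - (ε - δ) * 1/ (1ℚ - ε)
      ≡⟨ split x ε δ (1/ (1ℚ - δ)) (1/ (1ℚ - ε)) ⟩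
    x * ((1ℚ - δ) * 1/ (1ℚ - δ) - u) - (c - (1ℚ - ε) * 1/ (1ℚ - ε))
      ≡⟨ cong₂ (λ p q → x * (p - u) - (c - q)) (*-inverseʳ (1ℚ - δ)) (*-inverseʳ (1ℚ - ε)) ⟩
    x * (1ℚ - u) - (c - 1ℚ)
      ∎
    where
    open ≡-Reasoning
    split : ∀ x ε δ r s → x * (ε - δ) * r - (ε - δ) * s
                          ≡ x * ((1ℚ - δ) * r - (1ℚ - ε) * r) - ((1ℚ - δ) * s - (1ℚ - ε) * s)
    split = solve-∀ ℚ-ring

module ExchangeGraph {n : ℕ} (G : Graph n) (w : Fin n → ℚ) (A O : VSet n) (π : Fin n → Fin n) where
  open Ctx G w A O π

  -- N⁻ a o is N(o, A - a), so that N⁺ a is definitionally ⟦ a ⟧ ∪ ⋃ (C a) (N⁻ a).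
  N⁻ : Fin n → Fin n → VSet n
  N⁻ a o = N G ⟦ o ⟧ (_∖_ G A a)

  ∈N⁻⇒∈A : ∀ {a o v} → v ∈ₛ N⁻ a o → v ∈ₛ A
  ∈N⁻⇒∈A {a} {o} {v} v∈N⁻ = ∧-conicalˡ (A v) _ (∧-conicalˡ (_∖_ G A a v) _ v∈N⁻)

  ∈N⁻⇒≢ : ∀ {a o v} → v ∈ₛ N⁻ a o → v ≢ a
  ∈N⁻⇒≢ {a} {o} {v} v∈N⁻ v≡a = case trans (sym (cong not (dec-true (v ≟ᶠ a) v≡a))) v∉a of λ ()
    where
    v∉a : not (does (v ≟ᶠ a)) ≡ true
    v∉a = ∧-conicalʳ (A v) _ (∧-conicalˡ (_∖_ G A a v) _ v∈N⁻)

  ∈N⁻⇒∈N⁺ : ∀ {a o v} → o ∈ₛ C a → v ∈ₛ N⁻ a o → v ∈ₛ N⁺ a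
  ∈N⁻⇒∈N⁺ {a} {o} {v} o∈C v∈N⁻ =
    trans (cong (does (v ≟ᶠ a) ∨_) (any-allFin (λ o → C a o ∧ N⁻ a o v) o (cong₂ _∧_ o∈C v∈N⁻ )))
          (∨-zeroʳ (does (v ≟ᶠ a)))

  N-⊆-⟦⟧∪ : (B : VSet n) → (∀ v → v ∈ₛ B → v ∈ₛ A) →
            ∀ X a v → v ∈ₛ N G X B → v ∈ₛ (⟦ a ⟧ ∪ N G X (_∖_ G A a))
  N-⊆-⟦⟧∪ B B⊆A X a v v∈N = split (v ≟ᶠ a)
    where
    R = any (λ x → X x ∧ Graph.adj G x v) (allFin n) ∨ X v
    split : (v≟a : Dec (v ≡ a)) → does v≟a ∨ ((A v ∧ not (does v≟a)) ∧ R) ≡ true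
    split (yes _) = refl
    split (no _) rewrite B⊆A v (∧-conicalˡ (B v) R v∈N) = ∧-conicalʳ (B v) R v∈N

  module _ (ε : ℚ) where

    isolated⇒∈A : ∀ {a} → a ∈ₛ Isolated ε → a ∈ₛ A
    isolated⇒∈A {a} = ∧-conicalˡ (A a) _

    isolated⇒light : ∀ {a v} → a ∈ₛ Isolated ε → v ∈ₛ A → v ≢ a → v ∈ₛ N⁺ a → w v < (1ℚ - ε) * w a
    isolated⇒light {a} {v} a∈I v∈A v≢a v∈N⁺ = ≰⇒> λ heavy → case trans (sym (heavy⇒arc heavy)) no-arc of λ ()
      where
      no-arc : arc ε v a ≡ false
      no-arc = ∨-conicalʳ (arc ε a v) _
                 (any-allFin-false _ (not-injective (∧-conicalʳ (A a) _ a∈I)) v)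
      -- the type is arc ε v a unfolded, so that rewrite can reach its conjuncts
      heavy⇒arc : (1ℚ - ε) * w a ≤ w v →
                  A v ∧ A a ∧ not (does (v ≟ᶠ a)) ∧ N⁺ a v ∧ does (((1ℚ - ε) * w a) ≤? w v) ≡ true
      heavy⇒arc heavy rewrite v∈A | isolated⇒∈A a∈I | dec-false (v ≟ᶠ a) v≢a | v∈N⁺
                            | dec-true (((1ℚ - ε) * w a) ≤? w v) heavy = refl

    N⁻-light : ∀ {a o v} → a ∈ₛ Isolated ε → o ∈ₛ C a → v ∈ₛ N⁻ a o → w v < (1ℚ - ε) * w a
    N⁻-light a∈I o∈C v∈N⁻ = isolated⇒light a∈I (∈N⁻⇒∈A v∈N⁻) (∈N⁻⇒≢ v∈N⁻) (∈N⁻⇒∈N⁺ o∈C v∈N⁻)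

  module _ (0≤w : ∀ v → 0ℚ ≤ w v) where

    0≤w² : ∀ v → 0ℚ ≤ w v * w v
    0≤w² v = nonNeg-* (0≤w v) (0≤w v)

    wt-N-≤ : (B : VSet n) → (∀ v → v ∈ₛ B → v ∈ₛ A) → ∀ a o → wt (N G ⟦ o ⟧ B) ≤ w a + wt (N⁻ a o)
    wt-N-≤ B B⊆A a o = begin
      wt (N G ⟦ o ⟧ B)         ≤⟨ ΣS-mono-⊆ w 0≤w (N-⊆-⟦⟧∪ B B⊆A ⟦ o ⟧ a) ⟩
      wt (⟦ a ⟧ ∪ N⁻ a o)      ≤⟨ ΣS-∪ ⟦ a ⟧ (N⁻ a o) w 0≤w ⟩
      wt ⟦ a ⟧ + wt (N⁻ a o)   ≡⟨ cong (_+ wt (N⁻ a o)) (ΣS-⟦⟧ a w) ⟩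
      w a + wt (N⁻ a o)        ∎
      where open ≤-Reasoning

    wt²-N⁺-≤ : ∀ a → wt² (N⁺ a) ≤ w a * w a + ΣS (C a) (λ o → wt² (N⁻ a o))
    wt²-N⁺-≤ a = begin
      wt² (N⁺ a)                                  ≤⟨ ΣS-∪ ⟦ a ⟧ (⋃ (C a) (N⁻ a)) (λ v → w v * w v) 0≤w² ⟩
      wt² ⟦ a ⟧ + wt² (⋃ (C a) (N⁻ a))            ≤⟨ +-mono-≤ (≤-reflexive (ΣS-⟦⟧ a (λ v → w v * w v)))
                                                                (ΣS-⋃ (C a) (N⁻ a) (λ v → w v * w v) 0≤w²) ⟩
      w a * w a + ΣS (C a) (λ o → wt² (N⁻ a o))   ∎
      where open ≤-Reasoning

    module IsolatedVertexBound (B : VSet n) (B⊆A : ∀ v → v ∈ₛ B → v ∈ₛ A) (lopt : LocallyOptimal)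
             {δ ε : ℚ} (0≤δ : 0ℚ ≤ δ) (δ≤ε : δ ≤ ε) (ε<1 : ε < 1ℚ) where
      open ExchangeConstants δ≤ε ε<1

      δwNB : Fin n → ℚ
      δwNB a = ΣS (C a) (λ o → δ * wt (N G ⟦ o ⟧ B))

      ψ-lower-bound : ∀ {a o} → a ∈ₛ Isolated ε → o ∈ₛ C a →
        (1ℚ - c) * (w o * w o) + (1ℚ - u - δ) * (w a * w a) + w a * (δ * wt (N G ⟦ o ⟧ B))
          + (c - 1ℚ) * wt² (N⁻ a o)
        ≤ ψ a o
      ψ-lower-bound {a} {o} a∈I o∈C =
        ψ-lower-bound-ℚ (w o) (w a) (wt (N⁻ a o)) (wt² (N⁻ a o)) (wt (N G ⟦ o ⟧ B)) δ c u
                        (amgm-weighted {c} {u} (w a) (w o) c*u≡1 0≤u)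
                        (ΣS-square-≤ (N⁻ a o) w 0≤w {c} light)
                        (*-monoˡ-≤-nonNeg (δ * w a) {{nonNegative (nonNeg-* 0≤δ (0≤w a))}} (wt-N-≤ B B⊆A a o))
        where
        light : ∀ v → v ∈ₛ N⁻ a o → c * w v ≤ (1ℚ - δ) * w a
        light v v∈N⁻ = begin
          c * w v                ≤⟨ *-monoˡ-≤-nonNeg c {{nonNegative (≤-trans (nonNegative⁻¹ 1ℚ) 1≤c)}}
                                      (<⇒≤ (N⁻-light ε a∈I o∈C v∈N⁻)) ⟩
          c * ((1ℚ - ε) * w a)   ≡⟨ *-assoc c (1ℚ - ε) (w a) ⟨
          c * (1ℚ - ε) * w a     ≡⟨ cong (_* w a) c*[1-ε]≡1-δ ⟩
          (1ℚ - δ) * w a         ∎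
          where open ≤-Reasoning

      Ψ-lower-bound : ∀ {a} → a ∈ₛ Isolated ε →
        (1ℚ - c) * wt² (C a) + ℕ→ℚ (card (C a)) * ((1ℚ - u - δ) * (w a * w a)) + w a * δwNB a
          + (c - 1ℚ) * ΣS (C a) (λ o → wt² (N⁻ a o))
        ≤ Ψ a
      Ψ-lower-bound {a} a∈I = begin
        (1ℚ - c) * wt² (C a) + ℕ→ℚ (card (C a)) * ((1ℚ - u - δ) * (w a * w a)) + w a * δwNB a
          + (c - 1ℚ) * ΣS (C a) (λ o → wt² (N⁻ a o))
                                                  ≡⟨ cong₂ _+_ (cong₂ _+_ (cong₂ _+_
                                                       (ΣS-* (C a) (1ℚ - c) (λ o → w o * w o))
                                                       (ΣS-const (C a) ((1ℚ - u - δ) * (w a * w a))))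
                                                       (ΣS-* (C a) (w a) (λ o → δ * wt (N G ⟦ o ⟧ B))))
                                                       (ΣS-* (C a) (c - 1ℚ) (λ o → wt² (N⁻ a o))) ⟨
        ΣS (C a) f₁ + ΣS (C a) f₂ + ΣS (C a) f₃ + ΣS (C a) f₄
                                                  ≡⟨ cong (λ x → x + ΣS (C a) f₃ + ΣS (C a) f₄) (ΣS-+ (C a) f₁ f₂) ⟨
        ΣS (C a) (λ o → f₁ o + f₂ o) + ΣS (C a) f₃ + ΣS (C a) f₄
                                                  ≡⟨ cong (_+ ΣS (C a) f₄) (ΣS-+ (C a) (λ o → f₁ o + f₂ o) f₃) ⟨
        ΣS (C a) (λ o → f₁ o + f₂ o + f₃ o) + ΣS (C a) f₄
                                                  ≡⟨ ΣS-+ (C a) (λ o → f₁ o + f₂ o + f₃ o) f₄ ⟨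
        ΣS (C a) (λ o → f₁ o + f₂ o + f₃ o + f₄ o)
                                                  ≤⟨ ΣS-mono-≤ (C a) (λ o → ψ-lower-bound a∈I) ⟩
        Ψ a                                       ∎
        where
        open ≤-Reasoning
        f₁ f₂ f₃ f₄ : Fin n → ℚ
        f₁ o = (1ℚ - c) * (w o * w o)
        f₂ o = (1ℚ - u - δ) * (w a * w a)
        f₃ o = w a * (δ * wt (N G ⟦ o ⟧ B))
        f₄ o = (c - 1ℚ) * wt² (N⁻ a o)

      Δ+Ψ-lower-bound : ∀ {a} → a ∈ₛ Isolated ε →
        ((ρ ε δ (card (C a)) - δ * ℕ→ℚ (card (C a))) * w a + δwNB a) * w a ≤ Δ a + Ψ a
      Δ+Ψ-lower-bound {a} a∈I = begin
        ((ρ ε δ t - δ * ℕ→ℚ t) * w a + δwNB a) * w a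
          ≡⟨ cong (λ r → ((r - δ * ℕ→ℚ t) * w a + δwNB a) * w a) (ρ≡ (ℕ→ℚ t)) ⟩
        ((ℕ→ℚ t * (1ℚ - u) - (c - 1ℚ) - δ * ℕ→ℚ t) * w a + δwNB a) * w a
          ≤⟨ Δ+Ψ-lower-bound-ℚ (wt² (N⁺ a)) (wt² (C a)) (ΣS (C a) (λ o → wt² (N⁻ a o))) (δwNB a) (w a) (ℕ→ℚ t) δ c u
                               1≤c (lopt a (isolated⇒∈A ε a∈I)) (wt²-N⁺-≤ a) ⟩
        Δ a + ((1ℚ - c) * wt² (C a) + ℕ→ℚ t * ((1ℚ - u - δ) * (w a * w a)) + w a * δwNB a
                 + (c - 1ℚ) * ΣS (C a) (λ o → wt² (N⁻ a o)))
          ≤⟨ +-monoʳ-≤ (Δ a) (Ψ-lower-bound a∈I) ⟩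
        Δ a + Ψ a
          ∎
        where
        open ≤-Reasoning
        t = card (C a)

      isolated-bound : ∀ {a} → a ∈ₛ Isolated ε → 0ℚ < w a →
        (ρ ε δ (card (C a)) - δ * ℕ→ℚ (card (C a))) * w a + δwNB a ≤ (Δ a /ℚ w a) + (Ψ a /ℚ w a)
      isolated-bound {a} a∈I 0<wa =
        ≤-trans (p*r≤q⇒p≤q/r 0<wa (Δ+Ψ-lower-bound a∈I)) (≤-reflexive (/ℚ-distribʳ-+ (Δ a) (Ψ a) (w a)))

lemma6 : (k : ℕ) → k ≥ⁿ 1 → (n : ℕ) → (G : Graph n) → ClawFree G k →
         (w : Fin n → ℚ) → (∀ v → 0ℚ < w v) →
         (O A : VSet n) →
         (Independent G O × (∀ S → Independent G S → wsum w S ≤ wsum w O)) →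
         Independent G A →
         (∀ o → o ∈ₛ O → Σ (Fin n) λ a → a ∈ₛ N G ⟦ o ⟧ A) →
         (π : Fin n → Fin n) → Ctx.IsPi G w A O π →
         Ctx.LocallyOptimal G w A O π →
         (δ ε : ℚ) → 0ℚ ≤ δ → δ ≤ ε → ε < 1ℚ →
         (B : VSet n) → (∀ v → v ∈ₛ B → v ∈ₛ A) →
         let open Ctx G w A O π in
         ΣS (Isolated ε) (λ a → (Δ a /ℚ w a) + (Ψ a /ℚ w a))
           ≥
         (ΣS (Isolated ε) (λ a → (ρ ε δ (card (C a)) - δ * ℕ→ℚ (card (C a))) * w a)
           + ΣS (Isolated ε) (λ a → ΣS (C a) (λ o → δ * wt (N G ⟦ o ⟧ B))))
lemma6 _ _ n G _ w 0<w O A _ _ _ π _ lopt δ ε 0≤δ δ≤ε ε<1 B B⊆A = begin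
  ΣS I lower + ΣS I δwNB                   ≡⟨ ΣS-+ I lower δwNB ⟨
  ΣS I (λ a → lower a + δwNB a)            ≤⟨ ΣS-mono-≤ I (λ a a∈I → isolated-bound a∈I (0<w a)) ⟩
  ΣS I (λ a → (Δ a /ℚ w a) + (Ψ a /ℚ w a)) ∎
  where
  open Ctx G w A O π
  open ExchangeGraph.IsolatedVertexBound G w A O π (λ v → <⇒≤ (0<w v)) B B⊆A lopt 0≤δ δ≤ε ε<1
  open ≤-Reasoning
  I : VSet n
  I = Isolated ε
  lower : Fin n → ℚ
  lower a = (ρ ε δ (card (C a)) - δ * ℕ→ℚ (card (C a))) * w a
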